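{- For every integer $d \ge 3$ there are functions $g(d)$ and $f(d)$ with $g(d) \ge \frac{d}{2\log(d+1)}$ and $f(d) \le d!\, d$ such that for every $n \ge d$, the smallest $d$-hitting family of schedules for the antichain $\mathcal{A}_n$ on $n$ elements has size at least $g(d)\log n - O(1)$ and at most $f(d)\log n$ (logarithms to base $2$; the $O(1)$ term depends only on $d$).
   Context: The antichain $\mathcal{A}_n$ is the partial order on $n$ elements $v_1,\dots,v_n$ in which any two distinct elements are incomparable; its schedules are all $n!$ permutations of $v_1,\dots,v_n$. A $d$-tuple is a tuple $(a_1,\dots,a_d)$ of distinct elements; for an antichain every $d$-tuple is admissible. A schedule (permutation) hits $(a_1,\dots,a_d)$ if its restriction to $\{a_1,\dots,a_d\}$ is the sequence $a_1,\dots,a_d$. A family of schedules is $d$-hitting if every $d$-tuple is hit by some schedule in the family. -}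

module Defs where

open import Data.Nat using (ℕ; _≤_)
open import Data.Fin using (Fin; _≟_)
open import Data.List using (List; length; filter; allFin)
open import Data.List.Relation.Unary.All using (All)
open import Data.List.Relation.Unary.Any using (Any)
open import Data.List.Relation.Unary.Unique.Propositional using (Unique)
open import Data.List.Relation.Binary.Permutation.Propositional using (_↭_)
open import Data.Product using (Σ; _×_; ∃-syntax)
open import Relation.Binary.PropositionalEquality using (_≡_)

-- The antichain A_n has elements v_1..v_n, represented by Fin n.

-- A schedule of the antichain A_n: any permutation of its n elements,
-- written as the list of elements in scheduled order.
IsSchedule : (n : ℕ) → List (Fin n) → Set
IsSchedule n σ = σ ↭ allFin n

-- A d-tuple of distinct elements (a_1,...,a_d), given as a list of length d
-- without repetitions (every d-tuple is admissible for an antichain).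
IsTuple : (n d : ℕ) → List (Fin n) → Set
IsTuple n d a = (length a ≡ d) × Unique a

Hits : {n : ℕ} → List (Fin n) → List (Fin n) → Set
Hits σ a = filter (λ x → x ∈? a) σ ≡ a
  where open import Data.List.Membership.DecPropositional (_≟_ {_})

IsHittingFamily : (n d : ℕ) → List (List (Fin n)) → Set
IsHittingFamily n d F =
  All (IsSchedule n) F × (∀ a → IsTuple n d a → Any (λ σ → Hits σ a) F)

IsMinHittingSize : (n d m : ℕ) → Set
IsMinHittingSize n d m =
  (Σ (List (List (Fin n))) λ F → IsHittingFamily n d F × length F ≡ m)
  × (∀ F → IsHittingFamily n d F → m ≤ length F)

-- Upper bound: a fixed d-tuple is hit by exactly a 1/d! fraction of all n! schedules (every schedule
-- hits exactly one ordering of the tuple, and relabelling by a transposition shows that all orderings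
-- are hit equally often). By double counting, some schedule then hits a 1/d! fraction of any set of
-- tuples, so greedily chosen schedules leave at most (1 - 1/d!)^k n^d tuples unhit after k rounds.
-- Since (1 - 1/d!)^(d!) ≤ 2/5, this is below 1 after k = d! ⌊log₂ n^d⌋ rounds.
--
-- Lower bound: take t ≈ d/2 blocks of q ≈ (n - d)/t elements above d, and the pivot 0. A choice X of
-- one element per block gives, for each schedule of a hitting family F, the number (between 0 and t)
-- of chosen elements scheduled before the pivot. Two different choices X, X′ are told apart by any
-- schedule hitting the tuple (X where they differ, pivot, X′ where they differ, padding), so
-- q^t ≤ (t+1)^|F|, which rearranges to n^d ≤ (d+1)^(2|F| + 2d).

module Submission where

open import Defs
open import Data.Nat
  using (ℕ; zero; suc; pred; _+_; _*_; _^_; _∸_; _≤_; _≥_; _<_; z≤n; s≤s; _≤?_; _<?_; _!; NonZero; >-nonZero)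
import Data.Nat as ℕ
open import Data.Nat.Properties hiding (_≟_)
open import Data.Nat.DivMod using (_/_; _%_; _mod_; m/n*n≤m; m%n<n; m≡m%n+[m/n]*n; m<n⇒m%n≡m)
open import Data.Nat.ListAction using (sum)
open import Data.Nat.Tactic.RingSolver using (solve-∀)
open import Algebra.Properties.CommutativeSemigroup +-commutativeSemigroup using ()
  renaming (x∙yz≈y∙xz to +-left-comm)
open import Algebra.Properties.CommutativeSemigroup *-commutativeSemigroup using ()
  renaming (x∙yz≈y∙xz to *-left-comm)
open import Data.Fin using (Fin; _≟_; toℕ)
open import Data.Fin.Properties using (toℕ-fromℕ<) renaming (all? to ∀-Fin?)
open import Data.Fin.Permutation using (Permutation′; _⟨$⟩ʳ_; _⟨$⟩ˡ_; inverseˡ; inverseʳ; transpose)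
open import Data.List
  using (List; []; _∷_; _++_; map; length; filter; concatMap; cartesianProductWith; allFin; upTo)
open import Data.List.Properties
  using ( length-++; length-map; length-filter; length-tabulate; length-upTo; ∷-injective; ∷-injectiveˡ
        ; map-++; map-injective; map-id-local; ++-assoc; ++-identityʳ; filter-++; filter-accept; filter-some
        ; filter-≐; ≡-dec)
open import Data.List.Relation.Unary.All as All using (All; []; _∷_)
open import Data.List.Relation.Unary.Any as Any using (Any; here; there)
open import Data.List.Relation.Unary.AllPairs using ([]; _∷_)
open import Data.List.Relation.Unary.Unique.Propositional using (Unique)
import Data.List.Relation.Unary.Unique.Propositional.Properties as Unique
open import Data.List.Membership.Propositional using (_∈_; _∉_; find)
open import Data.List.Membership.Propositional.Properties
open import Data.List.Membership.Propositional.Properties.WithK using (unique∧set⇒bag)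
open import Data.List.Relation.Binary.Subset.Propositional using (_⊆_)
open import Data.List.Relation.Binary.Permutation.Propositional
  using (_↭_; ↭⇒↭ₛ; ↭-refl; ↭-prep; ↭-swap; ↭-trans; ↭-sym)
import Data.List.Relation.Binary.Permutation.Propositional as ↭
open import Data.List.Relation.Binary.Permutation.Propositional.Properties
  using (∈-resp-↭; shift; drop-mid; ↭-length; zoom)
import Data.List.Relation.Binary.Permutation.Setoid.Properties as Permutationₛ
open import Data.List.Relation.Binary.BagAndSetEquality using (∼bag⇒↭)
open import Data.Product using (Σ; _×_; _,_; proj₁; proj₂)
open import Data.Sum using (_⊎_; inj₁; inj₂)
open import Data.Empty using (⊥-elim)
open import Function using (_∘_)
open import Function.Bundles using (mk⇔)
open import Relation.Nullary using (¬_; Dec; yes; no; contradiction)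
open import Relation.Nullary.Decidable using (_×-dec_)
open import Relation.Unary using (Decidable)
open import Relation.Unary.Properties using (∁?)
open import Relation.Binary.Definitions using (DecidableEquality)
open import Relation.Binary.PropositionalEquality

private variable
  A B S : Set

Unique-resp-↭ : ∀ {xs ys : List A} → xs ↭ ys → Unique xs → Unique ys
Unique-resp-↭ xs↭ys = Permutationₛ.Unique-resp-↭ (setoid _) (↭⇒↭ₛ xs↭ys)

Unique∧⊆∧⊇⇒↭ : ∀ {xs ys : List A} → Unique xs → Unique ys → xs ⊆ ys → ys ⊆ xs → xs ↭ ys
Unique∧⊆∧⊇⇒↭ uxs uys xs⊆ys ys⊆xs = ∼bag⇒↭ (unique∧set⇒bag uxs uys (mk⇔ xs⊆ys ys⊆xs))

Unique∧⊆⇒length-≤ : ∀ {xs ys : List A} → Unique xs → xs ⊆ ys → length xs ≤ length ys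
Unique∧⊆⇒length-≤ {xs = []} _ _ = z≤n
Unique∧⊆⇒length-≤ {xs = x ∷ xs} {ys} (x∉xs ∷ uxs) xs⊆ys
  with ys₁ , ys₂ , refl ← ∈-∃++ (xs⊆ys (here refl)) =
  subst (suc (length xs) ≤_) (sym (↭-length (shift x ys₁ ys₂)))
    (s≤s (Unique∧⊆⇒length-≤ uxs xs⊆ys₁++ys₂))
  where
  xs⊆ys₁++ys₂ : xs ⊆ ys₁ ++ ys₂
  xs⊆ys₁++ys₂ {z} z∈xs with ∈-resp-↭ (shift x ys₁ ys₂) (xs⊆ys (there z∈xs))
  ... | here z≡x = ⊥-elim (All.lookup x∉xs z∈xs (sym z≡x))
  ... | there z∈ = z∈

Unique-++⁻ʳ : ∀ (xs : List A) {ys} → Unique (xs ++ ys) → Unique ys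
Unique-++⁻ʳ [] u = u
Unique-++⁻ʳ (x ∷ xs) (_ ∷ u) = Unique-++⁻ʳ xs u

Unique-++⁻-disjoint : ∀ (xs : List A) {ys x y} → Unique (xs ++ ys) → x ∈ xs → y ∈ ys → ¬ x ≡ y
Unique-++⁻-disjoint (x ∷ xs) (x∉ ∷ _) (here refl) y∈ = All.lookup x∉ (∈-++⁺ʳ xs y∈)
Unique-++⁻-disjoint (x ∷ xs) (_ ∷ u) (there x∈) y∈ = Unique-++⁻-disjoint xs u x∈ y∈

InjectiveOn : (A → B) → List A → Set
InjectiveOn f xs = ∀ {x y} → x ∈ xs → y ∈ xs → f x ≡ f y → x ≡ y

Unique-map : ∀ (f : A → B) {xs} → InjectiveOn f xs → Unique xs → Unique (map f xs)
Unique-map f {[]} _ _ = []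
Unique-map f {x ∷ xs} inj (x∉xs ∷ uxs) =
  All.tabulate fx∉ ∷ Unique-map f (λ p q → inj (there p) (there q)) uxs
  where
  fx∉ : ∀ {v} → v ∈ map f xs → ¬ f x ≡ v
  fx∉ v∈ fx≡v with y , y∈ , refl ← ∈-map⁻ f v∈ = All.lookup x∉xs y∈ (inj (here refl) (there y∈) fx≡v)

injection⇒length-≤ : ∀ (f : A → B) {xs ys} → Unique xs → InjectiveOn f xs →
  (∀ {x} → x ∈ xs → f x ∈ ys) → length xs ≤ length ys
injection⇒length-≤ f {xs} {ys} uxs inj maps-to =
  subst (_≤ length ys) (length-map f xs) (Unique∧⊆⇒length-≤ (Unique-map f inj uxs) image⊆ys)
  where
  image⊆ys : map f xs ⊆ ys
  image⊆ys v∈ with _ , x∈ , refl ← ∈-map⁻ f v∈ = maps-to x∈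

map-≡⇒≡ : ∀ {f g : A → B} {xs x} → map f xs ≡ map g xs → x ∈ xs → f x ≡ g x
map-≡⇒≡ {xs = _ ∷ _} eq (here refl) = proj₁ (∷-injective eq)
map-≡⇒≡ {xs = _ ∷ _} eq (there x∈) = map-≡⇒≡ (proj₂ (∷-injective eq)) x∈

sum-map-≤ : ∀ (f g : A → ℕ) xs → (∀ {x} → x ∈ xs → f x ≤ g x) → sum (map f xs) ≤ sum (map g xs)
sum-map-≤ f g [] _ = z≤n
sum-map-≤ f g (x ∷ xs) f≤g = +-mono-≤ (f≤g (here refl)) (sum-map-≤ f g xs (f≤g ∘ there))

sum-map-const : ∀ (c : ℕ) (xs : List A) → sum (map (λ _ → c) xs) ≡ length xs * c
sum-map-const c [] = refl
sum-map-const c (x ∷ xs) = cong (c +_) (sum-map-const c xs)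

*-distribˡ-sum-map : ∀ D (f : A → ℕ) xs → D * sum (map f xs) ≡ sum (map (λ x → D * f x) xs)
*-distribˡ-sum-map D f [] = *-zeroʳ D
*-distribˡ-sum-map D f (x ∷ xs) =
  trans (*-distribˡ-+ D (f x) _) (cong (D * f x +_) (*-distribˡ-sum-map D f xs))

sum-map-lower : ∀ (f : A → ℕ) c xs → (∀ {x} → x ∈ xs → c ≤ f x) → length xs * c ≤ sum (map f xs)
sum-map-lower f c [] _ = z≤n
sum-map-lower f c (x ∷ xs) c≤f = +-mono-≤ (c≤f (here refl)) (sum-map-lower f c xs (λ p → c≤f (there p)))

sum-map-upper : ∀ (f : A → ℕ) c xs → (∀ {x} → x ∈ xs → f x ≤ c) → sum (map f xs) ≤ length xs * c
sum-map-upper f c xs f≤c = subst (sum (map f xs) ≤_) (sum-map-const c xs) (sum-map-≤ f (λ _ → c) xs f≤c)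

reaches-average : ∀ (f : A → ℕ) D c x xs → length (x ∷ xs) * c ≤ D * sum (map f (x ∷ xs)) →
  Any (λ y → c ≤ D * f y) (x ∷ xs)
reaches-average f D c x xs avg with c ≤? D * f x
... | yes c≤ = here c≤
... | no c≰ with xs
...   | [] = ⊥-elim (c≰ (subst₂ _≤_ (+-identityʳ c) (cong (D *_) (+-identityʳ (f x))) avg))
...   | y ∷ ys =
  there (reaches-average f D c y ys (+-cancelˡ-≤ c _ _ (≤-trans avg′ (+-monoˡ-≤ _ (<⇒≤ (≰⇒> c≰))))))
  where
  avg′ : c + length (y ∷ ys) * c ≤ D * f x + D * sum (map f (y ∷ ys))
  avg′ = subst (c + length (y ∷ ys) * c ≤_) (*-distribˡ-+ D (f x) _) avg

module _ {H : S → A → Set} (H? : ∀ σ a → Dec (H σ a)) where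

  hitters : List S → A → ℕ
  hitters Ω a = length (filter (λ σ → H? σ a) Ω)

  hitCount : List A → S → ℕ
  hitCount R σ = length (filter (H? σ) R)

  private
    sum-hitCount-∷ : ∀ Ω a R →
      sum (map (hitCount (a ∷ R)) Ω) ≡ hitters Ω a + sum (map (hitCount R) Ω)
    sum-hitCount-∷ [] a R = refl
    sum-hitCount-∷ (σ ∷ Ω) a R with H? σ a
    ... | yes _ = cong suc (trans (cong (hitCount R σ +_) (sum-hitCount-∷ Ω a R))
                                  (+-left-comm (hitCount R σ) (hitters Ω a) _))
    ... | no _ = trans (cong (hitCount R σ +_) (sum-hitCount-∷ Ω a R))
                       (+-left-comm (hitCount R σ) (hitters Ω a) _)

  double-counting : ∀ Ω R → sum (map (hitters Ω) R) ≡ sum (map (hitCount R) Ω)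
  double-counting Ω [] = sym (trans (sum-map-const 0 Ω) (*-zeroʳ (length Ω)))
  double-counting Ω (a ∷ R) =
    trans (cong (hitters Ω a +_) (double-counting Ω R)) (sym (sum-hitCount-∷ Ω a R))

-- Enumerating words and permutations

words : ℕ → List A → List (List A)
words zero xs = [] ∷ []
words (suc k) xs = cartesianProductWith _∷_ xs (words k xs)

∈-words⁺ : ∀ {xs : List A} k {ys} → length ys ≡ k → All (_∈ xs) ys → ys ∈ words k xs
∈-words⁺ zero {[]} refl [] = here refl
∈-words⁺ (suc k) {y ∷ ys} refl (y∈ ∷ ys⊆) = ∈-cartesianProductWith⁺ _∷_ y∈ (∈-words⁺ k refl ys⊆)

∈-words⁻ : ∀ {xs : List A} k {ys} → ys ∈ words k xs → length ys ≡ k × All (_∈ xs) ys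
∈-words⁻ zero (here refl) = refl , []
∈-words⁻ {xs = xs} (suc k) ys∈
  with _ , _ , y∈ , zs∈ , refl ← ∈-cartesianProductWith⁻ _∷_ xs (words k xs) ys∈
  with len , zs⊆ ← ∈-words⁻ k zs∈ = cong suc len , y∈ ∷ zs⊆

length-cartesianProductWith : ∀ (f : A → B → S) xs ys →
  length (cartesianProductWith f xs ys) ≡ length xs * length ys
length-cartesianProductWith f [] ys = refl
length-cartesianProductWith f (x ∷ xs) ys =
  trans (length-++ (map (f x) ys)) (cong₂ _+_ (length-map (f x) ys) (length-cartesianProductWith f xs ys))

length-words : ∀ (xs : List A) k → length (words k xs) ≡ length xs ^ k
length-words xs zero = refl
length-words xs (suc k) =
  trans (length-cartesianProductWith _∷_ xs (words k xs)) (cong (length xs *_) (length-words xs k))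

Unique-words : ∀ {xs : List A} k → Unique xs → Unique (words k xs)
Unique-words zero _ = [] ∷ []
Unique-words (suc k) uxs = Unique.cartesianProductWith⁺ _∷_ ∷-injective uxs (Unique-words k uxs)

insertions : A → List A → List (List A)
insertions x [] = (x ∷ []) ∷ []
insertions x (y ∷ ys) = (x ∷ y ∷ ys) ∷ map (y ∷_) (insertions x ys)

permutations : List A → List (List A)
permutations [] = [] ∷ []
permutations (x ∷ xs) = concatMap (insertions x) (permutations xs)

length-insertions : ∀ (x : A) ys → length (insertions x ys) ≡ suc (length ys)
length-insertions x [] = refl
length-insertions x (y ∷ ys) =
  cong suc (trans (length-map (y ∷_) (insertions x ys)) (length-insertions x ys))

∈-insertions⁺ : ∀ (x : A) ys₁ ys₂ → ys₁ ++ x ∷ ys₂ ∈ insertions x (ys₁ ++ ys₂)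
∈-insertions⁺ x [] [] = here refl
∈-insertions⁺ x [] (y ∷ ys₂) = here refl
∈-insertions⁺ x (y ∷ ys₁) ys₂ = there (∈-map⁺ (y ∷_) (∈-insertions⁺ x ys₁ ys₂))

∈-insertions⁻ : ∀ {x : A} ys {zs} → zs ∈ insertions x ys → zs ↭ x ∷ ys
∈-insertions⁻ [] (here refl) = ↭-refl
∈-insertions⁻ (y ∷ ys) (here refl) = ↭-refl
∈-insertions⁻ {x = x} (y ∷ ys) (there zs∈) with _ , zs′∈ , refl ← ∈-map⁻ (y ∷_) zs∈ =
  ↭-trans (↭-prep y (∈-insertions⁻ ys zs′∈)) (↭-swap y x ↭-refl)

∈-permutations⁻ : ∀ (xs : List A) {ys} → ys ∈ permutations xs → ys ↭ xs
∈-permutations⁻ [] (here refl) = ↭-refl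
∈-permutations⁻ (x ∷ xs) ys∈
  with zs , ys∈ins , zs∈ ← ∈-concat⁻′ (map (insertions x) (permutations xs)) ys∈
  with σ , σ∈ , refl ← ∈-map⁻ (insertions x) zs∈ =
  ↭-trans (∈-insertions⁻ σ ys∈ins) (↭-prep x (∈-permutations⁻ xs σ∈))

∈-permutations⁺ : ∀ (xs : List A) {ys} → ys ↭ xs → ys ∈ permutations xs
∈-permutations⁺ [] {[]} _ = here refl
∈-permutations⁺ [] {y ∷ ys} ys↭[] with () ← ↭-length ys↭[]
∈-permutations⁺ (x ∷ xs) ys↭
  with ys₁ , ys₂ , refl ← ∈-∃++ (∈-resp-↭ (↭-sym ys↭) (here refl)) =
  ∈-concat⁺′ (∈-insertions⁺ x ys₁ ys₂)
    (∈-map⁺ (insertions x) (∈-permutations⁺ xs (drop-mid ys₁ [] ys↭)))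

length-permutations : ∀ (xs : List A) → length (permutations xs) ≡ length xs !
length-permutations [] = refl
length-permutations (x ∷ xs) = begin
  length (concatMap (insertions x) (permutations xs))
    ≡⟨ length-concatMap-insertions (permutations xs) (λ σ∈ → ↭-length (∈-permutations⁻ xs σ∈)) ⟩
  length (permutations xs) * suc (length xs)          ≡⟨ cong (_* suc (length xs)) (length-permutations xs) ⟩
  length xs ! * suc (length xs)                       ≡⟨ *-comm (length xs !) (suc (length xs)) ⟩
  suc (length xs) !                                   ∎
  where
  open ≡-Reasoning
  length-concatMap-insertions : ∀ L → (∀ {σ} → σ ∈ L → length σ ≡ length xs) →
    length (concatMap (insertions x) L) ≡ length L * suc (length xs)
  length-concatMap-insertions [] _ = refl
  length-concatMap-insertions (σ ∷ L) len =
    trans (length-++ (insertions x σ))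
      (cong₂ _+_ (trans (length-insertions x σ) (cong suc (len (here refl))))
                 (length-concatMap-insertions L (λ p → len (there p))))

-- Greedy covering

length-filter-+-∁ : ∀ {P : A → Set} (P? : Decidable P) xs →
  length (filter P? xs) + length (filter (∁? P?) xs) ≡ length xs
length-filter-+-∁ P? [] = refl
length-filter-+-∁ P? (x ∷ xs) with P? x
... | yes _ = cong suc (length-filter-+-∁ P? xs)
... | no _ = trans (+-suc _ _) (cong suc (length-filter-+-∁ P? xs))

module _ {H : S → A → Set} (H? : ∀ σ a → Dec (H σ a)) where

  well-hitting : ∀ D {σ₀} Ω → σ₀ ∈ Ω → (R : List A) →
    (∀ {a} → a ∈ R → length Ω ≤ D * hitters H? Ω a) →
    Σ S λ σ → σ ∈ Ω × length R ≤ D * hitCount H? R σ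
  well-hitting D (σ₀ ∷ Ω) _ R hit = find (reaches-average (hitCount H? R) D (length R) σ₀ Ω average)
    where
    open ≤-Reasoning
    average : length (σ₀ ∷ Ω) * length R ≤ D * sum (map (hitCount H? R) (σ₀ ∷ Ω))
    average = begin
      length (σ₀ ∷ Ω) * length R                       ≡⟨ *-comm (length (σ₀ ∷ Ω)) (length R) ⟩
      length R * length (σ₀ ∷ Ω)                       ≤⟨ sum-map-lower _ _ R hit ⟩
      sum (map (λ a → D * hitters H? (σ₀ ∷ Ω) a) R)     ≡⟨ *-distribˡ-sum-map D _ R ⟨
      D * sum (map (hitters H? (σ₀ ∷ Ω)) R)             ≡⟨ cong (D *_) (double-counting H? (σ₀ ∷ Ω) R) ⟩
      D * sum (map (hitCount H? R) (σ₀ ∷ Ω))            ∎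

  unhit : List S → List A → List A
  unhit [] T = T
  unhit (σ ∷ F) T = filter (∁? (H? σ)) (unhit F T)

  unhit-⊆ : ∀ F T → unhit F T ⊆ T
  unhit-⊆ [] T a∈ = a∈
  unhit-⊆ (σ ∷ F) T a∈ = unhit-⊆ F T (proj₁ (∈-filter⁻ (∁? (H? σ)) a∈))

  hit-or-unhit : ∀ F T {a} → a ∈ T → Any (λ σ → H σ a) F ⊎ a ∈ unhit F T
  hit-or-unhit [] T a∈ = inj₂ a∈
  hit-or-unhit (σ ∷ F) T {a} a∈ with hit-or-unhit F T a∈
  ... | inj₁ hit = inj₁ (there hit)
  ... | inj₂ a∈U with H? σ a
  ...   | yes h = inj₁ (here h)
  ...   | no ¬h = inj₂ (∈-filter⁺ (∁? (H? σ)) a∈U ¬h)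

  private
    unhit-shrinks : ∀ E σ R → length R ≤ suc E * hitCount H? R σ →
      suc E * length (filter (∁? (H? σ)) R) ≤ E * length R
    unhit-shrinks E σ R many-hit = +-cancelʳ-≤ (length R) _ _ (begin
      D * r′ + length R  ≤⟨ +-monoʳ-≤ (D * r′) many-hit ⟩
      D * r′ + D * h     ≡⟨ *-distribˡ-+ D r′ h ⟨
      D * (r′ + h)       ≡⟨ cong (D *_) (trans (+-comm r′ h) (length-filter-+-∁ (H? σ) R)) ⟩
      D * length R       ≡⟨ +-comm (length R) (E * length R) ⟩
      E * length R + length R ∎)
      where
      open ≤-Reasoning
      D h r′ : ℕ
      D = suc E
      h = hitCount H? R σ
      r′ = length (filter (∁? (H? σ)) R)

  -- Each greedy step keeps at most an (E/(E+1)) fraction of the tuples not hit so far.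
  greedy : ∀ E {σ₀} Ω → σ₀ ∈ Ω → (T : List A) →
    (∀ {a} → a ∈ T → length Ω ≤ suc E * hitters H? Ω a) → ∀ k →
    Σ (List S) λ F → length F ≡ k × All (_∈ Ω) F × suc E ^ k * length (unhit F T) ≤ E ^ k * length T
  greedy E Ω σ₀∈Ω T hit zero = [] , refl , [] , ≤-refl
  greedy E Ω σ₀∈Ω T hit (suc k)
    with F , lenF , F⊆Ω , bound ← greedy E Ω σ₀∈Ω T hit k
    with σ , σ∈Ω , many-hit ← well-hitting (suc E) Ω σ₀∈Ω (unhit F T) (λ a∈ → hit (unhit-⊆ F T a∈)) =
    σ ∷ F , cong suc lenF , σ∈Ω ∷ F⊆Ω , (begin
      (D * D ^ k) * r′       ≡⟨ trans (*-assoc D (D ^ k) r′) (*-left-comm D (D ^ k) r′) ⟩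
      D ^ k * (D * r′)       ≤⟨ *-monoʳ-≤ (D ^ k) (unhit-shrinks E σ R many-hit) ⟩
      D ^ k * (E * length R) ≡⟨ *-left-comm (D ^ k) E (length R) ⟩
      E * (D ^ k * length R) ≤⟨ *-monoʳ-≤ E bound ⟩
      E * (E ^ k * length T) ≡⟨ *-assoc E (E ^ k) (length T) ⟨
      (E * E ^ k) * length T ∎)
    where
    open ≤-Reasoning
    D : ℕ
    D = suc E
    R : List A
    R = unhit F T
    r′ : ℕ
    r′ = length (filter (∁? (H? σ)) R)

  greedy-hits-all : ∀ E {σ₀} Ω → σ₀ ∈ Ω → (T : List A) →
    (∀ {a} → a ∈ T → length Ω ≤ suc E * hitters H? Ω a) → ∀ k → E ^ k * length T < suc E ^ k →
    Σ (List S) λ F → length F ≡ k × All (_∈ Ω) F × (∀ {a} → a ∈ T → Any (λ σ → H σ a) F)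
  greedy-hits-all E Ω σ₀∈Ω T hit k few-left
    with F , lenF , F⊆Ω , bound ← greedy E Ω σ₀∈Ω T hit k =
    F , lenF , F⊆Ω , hits-all
    where
    nothing-left : ∀ {a} → ¬ a ∈ unhit F T
    nothing-left {a} a∈ with unhit F T
    ... | b ∷ U = <⇒≱ few-left (begin
      suc E ^ k                          ≤⟨ m≤m*n (suc E ^ k) (length (b ∷ U)) ⟩
      suc E ^ k * length (b ∷ U)         ≤⟨ bound ⟩
      E ^ k * length T                   ∎)
      where
      open ≤-Reasoning
      instance
        D^k≢0 : NonZero (suc E ^ k)
        D^k≢0 = m^n≢0 (suc E) k
    hits-all : ∀ {a} → a ∈ T → Any (λ σ → H σ a) F
    hits-all a∈ with hit-or-unhit F T a∈
    ... | inj₁ hit = hit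
    ... | inj₂ a∈U = ⊥-elim (nothing-left a∈U)

^-distribʳ-* : ∀ a b k → (a * b) ^ k ≡ a ^ k * b ^ k
^-distribʳ-* a b zero = refl
^-distribʳ-* a b (suc k) = trans (cong (a * b *_) (^-distribʳ-* a b k)) (shuffle a b (a ^ k) (b ^ k))
  where
  shuffle : ∀ a b x y → a * b * (x * y) ≡ a * x * (b * y)
  shuffle = solve-∀

-- 2a²(a+1)^k ≥ 2a² (a^k + k a^(k-1) + (k choose 2) a^(k-2)), the first three binomial terms.
binomial-three-terms : ∀ a k →
  a ^ k * (2 * a * a + 2 * k * a + k * k) ≤ 2 * a * a * (a + 1) ^ k + a ^ k * k
binomial-three-terms a zero = ≤-reflexive (base a)
  where
  base : ∀ a → 1 * (2 * a * a + 2 * 0 * a + 0 * 0) ≡ 2 * a * a * 1 + 1 * 0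
  base = solve-∀
binomial-three-terms a (suc k) = +-cancelʳ-≤ (X * k * (a + 1)) _ _ (begin
  a * X * Q (suc k) + X * k * (a + 1)         ≤⟨ step ⟩
  X * Q k * (a + 1) + X * a * (k + 1)
    ≤⟨ +-monoˡ-≤ (X * a * (k + 1)) (*-monoˡ-≤ (a + 1) (binomial-three-terms a k)) ⟩
  (2 * a * a * Y + X * k) * (a + 1) + X * a * (k + 1)  ≡⟨ regroup a k X Y ⟩
  2 * a * a * ((a + 1) * Y) + a * X * suc k + X * k * (a + 1) ∎)
  where
  open ≤-Reasoning
  X Y : ℕ
  X = a ^ k
  Y = (a + 1) ^ k
  Q : ℕ → ℕ
  Q k = 2 * a * a + 2 * k * a + k * k
  regroup : ∀ a k X Y → (2 * a * a * Y + X * k) * (a + 1) + X * a * (k + 1) ≡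
                        2 * a * a * ((a + 1) * Y) + a * X * suc k + X * k * (a + 1)
  regroup = solve-∀
  -- the two sides differ by X * (k * k - k)
  step-identity : ∀ a k X → a * X * (2 * a * a + 2 * suc k * a + suc k * suc k) + X * k * (a + 1) + X * k * k ≡
                            X * (2 * a * a + 2 * k * a + k * k) * (a + 1) + X * a * (k + 1) + X * k
  step-identity = solve-∀
  step : a * X * Q (suc k) + X * k * (a + 1) ≤ X * Q k * (a + 1) + X * a * (k + 1)
  step = +-cancelʳ-≤ (X * k * k) _ _ (begin
    a * X * Q (suc k) + X * k * (a + 1) + X * k * k ≡⟨ step-identity a k X ⟩
    X * Q k * (a + 1) + X * a * (k + 1) + X * k     ≤⟨ +-monoʳ-≤ _ (m*n≤m*n*n X k) ⟩
    X * Q k * (a + 1) + X * a * (k + 1) + X * k * k ∎)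
    where
    m*n≤m*n*n : ∀ m n → m * n ≤ m * n * n
    m*n≤m*n*n m zero = subst₂ _≤_ (sym (*-zeroʳ m)) (sym (*-zeroʳ (m * 0))) z≤n
    m*n≤m*n*n m (suc n) = m≤m*n (m * suc n) (suc n)

five-halves : ∀ a → 5 * a ^ suc a ≤ 2 * suc a ^ suc a
five-halves zero = z≤n
five-halves a@(suc _) = *-cancelˡ-≤ (a * a) (begin
  a * a * (5 * X)                       ≡⟨ expand₁ a X ⟩
  X * (5 * a * a)                       ≤⟨ m≤m+n _ _ ⟩
  X * (5 * a * a) + X * (3 * a)         ≤⟨ +-cancelʳ-≤ (X * (a + 1)) _ _ (begin
      X * (5 * a * a) + X * (3 * a) + X * (a + 1)   ≡⟨ expand₂ a X ⟨
      X * (2 * a * a + 2 * suc a * a + suc a * suc a) ≤⟨ binomial-three-terms a (suc a) ⟩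
      2 * a * a * Y + X * suc a                     ≡⟨ cong (2 * a * a * Y +_) (cong (X *_) (+-comm 1 a)) ⟩
      2 * a * a * Y + X * (a + 1)                   ∎) ⟩
  2 * a * a * Y                         ≡⟨ cong (2 * a * a *_) (cong (_^ suc a) (+-comm a 1)) ⟩
  2 * a * a * suc a ^ suc a             ≡⟨ expand₃ a (suc a ^ suc a) ⟩
  a * a * (2 * suc a ^ suc a)           ∎)
  where
  open ≤-Reasoning
  X Y : ℕ
  X = a ^ suc a
  Y = (a + 1) ^ suc a
  expand₁ : ∀ a X → a * a * (5 * X) ≡ X * (5 * a * a)
  expand₁ = solve-∀
  expand₂ : ∀ a X → X * (2 * a * a + 2 * suc a * a + suc a * suc a) ≡ X * (5 * a * a) + X * (3 * a) + X * (a + 1)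
  expand₂ = solve-∀
  expand₃ : ∀ a Z → 2 * a * a * Z ≡ a * a * (2 * Z)
  expand₃ = solve-∀

power-of-two-bracket : ∀ x → 1 ≤ x → Σ ℕ λ j → 2 ^ j ≤ x × x < 2 * 2 ^ j
power-of-two-bracket (suc zero) _ = 0 , s≤s z≤n , s≤s (s≤s z≤n)
power-of-two-bracket (suc (suc x)) _ with power-of-two-bracket (suc x) (s≤s z≤n)
... | j , 2^j≤ , <2^[1+j] with suc (suc x) <? 2 * 2 ^ j
...   | yes lt = j , m≤n⇒m≤1+n 2^j≤ , lt
...   | no ≮ = suc j , ≤-reflexive (sym x≡) , subst (_< 2 * (2 * 2 ^ j)) (sym x≡) doubling
  where
  x≡ : suc (suc x) ≡ 2 * 2 ^ j
  x≡ = ≤-antisym <2^[1+j] (≮⇒≥ ≮)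
  doubling : 2 ^ suc j < 2 * 2 ^ suc j
  doubling = subst (2 ^ suc j <_) (*-comm (2 ^ suc j) 2) (m<m*n (2 ^ suc j) 2 {{m^n≢0 2 (suc j)}} (s≤s (s≤s z≤n)))

2*4^j≤5^j : ∀ j → 4 ≤ j → 2 * 4 ^ j ≤ 5 ^ j
2*4^j≤5^j j 4≤j with i , refl ← m≤n⇒∃[o]m+o≡n 4≤j = go i
  where
  go : ∀ i → 2 * 4 ^ (4 + i) ≤ 5 ^ (4 + i)
  go zero = ≤ᵇ⇒≤ 512 625 _
  go (suc i) = begin
    2 * (4 * 4 ^ (4 + i)) ≡⟨ *-left-comm 2 4 (4 ^ (4 + i)) ⟩
    4 * (2 * 4 ^ (4 + i)) ≤⟨ *-mono-≤ (n≤1+n 4) (go i) ⟩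
    5 * 5 ^ (4 + i)       ∎
    where open ≤-Reasoning

-- (1 - 1/D)^(D j) X ≤ (2/5)^j X < 2 (4/5)^j ≤ 1, as X < 2^(j+1) forces j ≥ 4.
few-rounds-suffice : ∀ E j X → 16 ≤ X → X < 2 * 2 ^ j → E ^ (suc E * j) * X < suc E ^ (suc E * j)
few-rounds-suffice E j X 16≤X X<2^[1+j] = *-cancelˡ-< (5 ^ j) _ _ (begin-strict
  5 ^ j * (E ^ (D * j) * X)       ≡⟨ *-assoc (5 ^ j) _ X ⟨
  5 ^ j * E ^ (D * j) * X         ≤⟨ *-monoˡ-≤ X (power (five-halves E)) ⟩
  2 ^ j * D ^ (D * j) * X         <⟨ *-monoʳ-< (2 ^ j * D ^ (D * j)) {{nonZero}} X<2^[1+j] ⟩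
  2 ^ j * D ^ (D * j) * (2 * 2 ^ j) ≡⟨ regroup (2 ^ j) (D ^ (D * j)) ⟩
  2 * (2 ^ j * 2 ^ j) * D ^ (D * j) ≡⟨ cong (λ z → 2 * z * D ^ (D * j)) (^-distribʳ-* 2 2 j) ⟨
  2 * 4 ^ j * D ^ (D * j)         ≤⟨ *-monoˡ-≤ (D ^ (D * j)) (2*4^j≤5^j j 4≤j) ⟩
  5 ^ j * D ^ (D * j)             ∎)
  where
  open ≤-Reasoning
  D : ℕ
  D = suc E
  nonZero : NonZero (2 ^ j * D ^ (D * j))
  nonZero = m*n≢0 (2 ^ j) (D ^ (D * j)) {{m^n≢0 2 j}} {{m^n≢0 D (D * j)}}
  power : ∀ {c e} → c * E ^ D ≤ e * D ^ D → c ^ j * E ^ (D * j) ≤ e ^ j * D ^ (D * j)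
  power {c} {e} le = subst₂ _≤_
    (trans (^-distribʳ-* c (E ^ D) j) (cong (c ^ j *_) (^-*-assoc E D j)))
    (trans (^-distribʳ-* e (D ^ D) j) (cong (e ^ j *_) (^-*-assoc D D j)))
    (^-monoˡ-≤ j le)
  regroup : ∀ x y → x * y * (2 * x) ≡ 2 * (x * x) * y
  regroup = solve-∀
  4≤j : 4 ≤ j
  4≤j with 4 ≤? j
  ... | yes le = le
  ... | no ≰ = contradiction (≤-trans X<2^[1+j] (≤-trans (^-monoʳ-≤ 2 (≰⇒> ≰)) 16≤X)) (<-irrefl refl)

-- Schedules of the antichain and the upper bound

module Schedules (n : ℕ) where

  open import Data.List.Membership.DecPropositional (_≟_ {n}) using (_∈?_)
  open import Data.List.Relation.Unary.Unique.DecPropositional (_≟_ {n}) using (unique?)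

  Covering : List (Fin n) → Set
  Covering σ = ∀ z → z ∈ σ

  schedules : List (List (Fin n))
  schedules = filter (λ σ → unique? σ ×-dec ∀-Fin? (_∈? σ)) (words n (allFin n))

  ∈-schedules⁺ : ∀ {σ} → length σ ≡ n → Unique σ → Covering σ → σ ∈ schedules
  ∈-schedules⁺ {σ} len uσ cov =
    ∈-filter⁺ _ (∈-words⁺ n len (All.tabulate (λ {z} _ → ∈-allFin z))) (uσ , cov)

  ∈-schedules⁻ : ∀ {σ} → σ ∈ schedules → length σ ≡ n × Unique σ × Covering σ
  ∈-schedules⁻ σ∈ with σ∈words , uσ , cov ← ∈-filter⁻ _ {xs = words n (allFin n)} σ∈ =
    proj₁ (∈-words⁻ n σ∈words) , uσ , cov

  Unique∧Covering⇒IsSchedule : ∀ {σ} → Unique σ → Covering σ → IsSchedule n σ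
  Unique∧Covering⇒IsSchedule uσ cov =
    Unique∧⊆∧⊇⇒↭ uσ (Unique.allFin⁺ n) (λ {z} _ → ∈-allFin z) (λ {z} _ → cov z)

  Unique-schedules : Unique schedules
  Unique-schedules = Unique.filter⁺ _ (Unique-words n (Unique.allFin⁺ n))

  Hits? : ∀ σ a → Dec (Hits σ a)
  Hits? σ a = ≡-dec _≟_ (filter (_∈? a) σ) a

  #hitting : List (Fin n) → ℕ
  #hitting = hitters Hits? schedules

  module _ (π : Permutation′ n) where

    private
      relabel : List (Fin n) → List (Fin n)
      relabel = map (π ⟨$⟩ʳ_)

      relabel-injective : ∀ {x y} → π ⟨$⟩ʳ x ≡ π ⟨$⟩ʳ y → x ≡ y
      relabel-injective {x} {y} eq = trans (sym (inverseˡ π)) (trans (cong (π ⟨$⟩ˡ_) eq) (inverseˡ π))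

      ∈-relabel⁻ : ∀ {z c} → π ⟨$⟩ʳ z ∈ relabel c → z ∈ c
      ∈-relabel⁻ z∈ with _ , y∈ , eq ← ∈-map⁻ (π ⟨$⟩ʳ_) z∈ = subst (_∈ _) (sym (relabel-injective eq)) y∈

      filter-relabel : ∀ c σ → filter (_∈? relabel c) (relabel σ) ≡ relabel (filter (_∈? c) σ)
      filter-relabel c [] = refl
      filter-relabel c (s ∷ σ) with π ⟨$⟩ʳ s ∈? relabel c | s ∈? c
      ... | yes _   | yes _   = cong (π ⟨$⟩ʳ s ∷_) (filter-relabel c σ)
      ... | no _    | no _    = filter-relabel c σ
      ... | yes fs∈ | no s∉   = ⊥-elim (s∉ (∈-relabel⁻ fs∈))
      ... | no fs∉  | yes s∈  = ⊥-elim (fs∉ (∈-map⁺ (π ⟨$⟩ʳ_) s∈))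

      ∈-schedules-relabel : ∀ {σ} → σ ∈ schedules → relabel σ ∈ schedules
      ∈-schedules-relabel {σ} σ∈ with len , uσ , cov ← ∈-schedules⁻ σ∈ =
        ∈-schedules⁺ (trans (length-map (π ⟨$⟩ʳ_) σ) len)
          (Unique-map _ (λ _ _ → relabel-injective) uσ)
          (λ z → subst (_∈ relabel σ) (inverseʳ π) (∈-map⁺ (π ⟨$⟩ʳ_) (cov (π ⟨$⟩ˡ z))))

    #hitting-relabel : ∀ c → #hitting c ≤ #hitting (relabel c)
    #hitting-relabel c = injection⇒length-≤ relabel (Unique.filter⁺ _ Unique-schedules)
      (λ _ _ → map-injective relabel-injective) maps-to
      where
      maps-to : ∀ {σ} → σ ∈ filter (λ σ → Hits? σ c) schedules →
        relabel σ ∈ filter (λ σ → Hits? σ (relabel c)) schedules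
      maps-to {σ} σ∈ with σ∈Ω , hit ← ∈-filter⁻ (λ σ → Hits? σ c) {xs = schedules} σ∈ =
        ∈-filter⁺ (λ σ → Hits? σ (relabel c)) (∈-schedules-relabel σ∈Ω)
          (trans (filter-relabel c σ) (cong relabel hit))

  module _ (x y : Fin n) where

    private
      τ : Fin n → Fin n
      τ = transpose x y ⟨$⟩ʳ_

    transpose-x : τ x ≡ y
    transpose-x with x ≟ x
    ... | yes _ = refl
    ... | no x≢x = ⊥-elim (x≢x refl)

    transpose-y : ¬ x ≡ y → τ y ≡ x
    transpose-y x≢y with y ≟ x
    ... | yes y≡x = ⊥-elim (x≢y (sym y≡x))
    ... | no _ with y ≟ y
    ...   | yes _ = refl
    ...   | no y≢y = ⊥-elim (y≢y refl)

    transpose-other : ∀ {z} → ¬ z ≡ x → ¬ z ≡ y → τ z ≡ z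
    transpose-other {z} z≢x z≢y with z ≟ x
    ... | yes z≡x = ⊥-elim (z≢x z≡x)
    ... | no _ with z ≟ y
    ...   | yes z≡y = ⊥-elim (z≢y z≡y)
    ...   | no _ = refl

    #hitting-swap : ∀ p r → Unique (p ++ x ∷ y ∷ r) →
      #hitting (p ++ x ∷ y ∷ r) ≤ #hitting (p ++ y ∷ x ∷ r)
    #hitting-swap p r u =
      subst (λ c → #hitting (p ++ x ∷ y ∷ r) ≤ #hitting c) relabel-swaps
        (#hitting-relabel (transpose x y) (p ++ x ∷ y ∷ r))
      where
      x≢y : ¬ x ≡ y
      x≢y with (x≢y ∷ _) ∷ _ ← Unique-++⁻ʳ p u = x≢y
      x∉r : All (λ z → ¬ x ≡ z) r
      x∉r with (_ ∷ x∉r) ∷ _ ← Unique-++⁻ʳ p u = x∉r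
      y∉r : All (λ z → ¬ y ≡ z) r
      y∉r with _ ∷ y∉r ∷ _ ← Unique-++⁻ʳ p u = y∉r
      relabel-swaps : map τ (p ++ x ∷ y ∷ r) ≡ p ++ y ∷ x ∷ r
      relabel-swaps = trans (map-++ τ p (x ∷ y ∷ r)) (cong₂ _++_
        (map-id-local (All.tabulate λ z∈p → transpose-other (Unique-++⁻-disjoint p u z∈p (here refl))
                                                              (Unique-++⁻-disjoint p u z∈p (there (here refl)))))
        (cong₂ _∷_ transpose-x (cong₂ _∷_ (transpose-y x≢y)
          (map-id-local (All.zipWith (λ (x≢z , y≢z) → transpose-other (x≢z ∘ sym) (y≢z ∘ sym)) (x∉r , y∉r))))))

  private
    #hitting-↭-in-context : ∀ {b c} → b ↭ c → ∀ p s → Unique (p ++ b ++ s) →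
      #hitting (p ++ b ++ s) ≤ #hitting (p ++ c ++ s)
    #hitting-↭-in-context ↭.refl p s u = ≤-refl
    #hitting-↭-in-context {x ∷ b} {x ∷ c} (↭.prep x b↭c) p s u =
      subst₂ (λ u v → #hitting u ≤ #hitting v) (++-assoc p (x ∷ []) (b ++ s)) (++-assoc p (x ∷ []) (c ++ s))
        (#hitting-↭-in-context b↭c (p ++ x ∷ []) s (subst Unique (sym (++-assoc p (x ∷ []) (b ++ s))) u))
    #hitting-↭-in-context {x ∷ y ∷ b} {y ∷ x ∷ c} (↭.swap x y b↭c) p s u = ≤-trans
      (subst₂ (λ u v → #hitting u ≤ #hitting v)
        (++-assoc p (x ∷ y ∷ []) (b ++ s)) (++-assoc p (x ∷ y ∷ []) (c ++ s))
        (#hitting-↭-in-context b↭c (p ++ x ∷ y ∷ []) s (subst Unique (sym (++-assoc p (x ∷ y ∷ []) (b ++ s))) u)))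
      (#hitting-swap x y p (c ++ s) (Unique-resp-↭ (zoom p {s} (↭-prep x (↭-prep y b↭c))) u))
    #hitting-↭-in-context (↭.trans b↭c c↭d) p s u =
      ≤-trans (#hitting-↭-in-context b↭c p s u)
        (#hitting-↭-in-context c↭d p s (Unique-resp-↭ (zoom p {s} b↭c) u))

  #hitting-↭ : ∀ {b c} → b ↭ c → Unique b → #hitting b ≤ #hitting c
  #hitting-↭ {b} {c} b↭c u = subst₂ (λ u v → #hitting u ≤ #hitting v) (++-identityʳ b) (++-identityʳ c)
    (#hitting-↭-in-context b↭c [] [] (subst Unique (sym (++-identityʳ b)) u))

  restriction-⊆ : ∀ σ a → filter (_∈? a) σ ⊆ a
  restriction-⊆ σ a z∈ = proj₂ (∈-filter⁻ (_∈? a) {xs = σ} z∈)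

  ⊆-restriction : ∀ {σ} a → Covering σ → a ⊆ filter (_∈? a) σ
  ⊆-restriction a cov {z} z∈a = ∈-filter⁺ (_∈? a) (cov z) z∈a

  Hits-restriction : ∀ {σ} a → Covering σ → Hits σ (filter (_∈? a) σ)
  Hits-restriction {σ} a cov =
    filter-≐ (_∈? filter (_∈? a) σ) (_∈? a) (restriction-⊆ σ a , ⊆-restriction a cov) σ

  -- Every schedule hits exactly one ordering of a, and all orderings are hit equally often.
  schedules≤d!*#hitting : ∀ a → Unique a → length schedules ≤ length a ! * #hitting a
  schedules≤d!*#hitting a ua = begin
    length schedules                          ≡⟨ *-identityʳ (length schedules) ⟨
    length schedules * 1                      ≤⟨ sum-map-lower _ 1 schedules hits-some-ordering ⟩
    sum (map (hitCount Hits? orderings) schedules) ≡⟨ double-counting Hits? schedules orderings ⟨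
    sum (map #hitting orderings)              ≤⟨ sum-map-upper #hitting (#hitting a) orderings ordering-≤ ⟩
    length orderings * #hitting a             ≡⟨ cong (_* #hitting a) (length-permutations a) ⟩
    length a ! * #hitting a                   ∎
    where
    open ≤-Reasoning
    orderings : List (List (Fin n))
    orderings = permutations a
    ordering-≤ : ∀ {b} → b ∈ orderings → #hitting b ≤ #hitting a
    ordering-≤ b∈ = #hitting-↭ (∈-permutations⁻ a b∈) (Unique-resp-↭ (↭-sym (∈-permutations⁻ a b∈)) ua)
    hits-some-ordering : ∀ {σ} → σ ∈ schedules → 1 ≤ hitCount Hits? orderings σ
    hits-some-ordering {σ} σ∈ with _ , uσ , cov ← ∈-schedules⁻ σ∈ =
      filter-some (Hits? σ) (Any.map (λ { refl → Hits-restriction a cov }) restriction∈orderings)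
      where
      restriction↭a : filter (_∈? a) σ ↭ a
      restriction↭a = Unique∧⊆∧⊇⇒↭ (Unique.filter⁺ (_∈? a) uσ) ua (restriction-⊆ σ a) (⊆-restriction a cov)
      restriction∈orderings : filter (_∈? a) σ ∈ orderings
      restriction∈orderings = ∈-permutations⁺ a restriction↭a

  allFin∈schedules : allFin n ∈ schedules
  allFin∈schedules = ∈-schedules⁺ (length-tabulate (λ i → i)) (Unique.allFin⁺ n) ∈-allFin

  tuples : ℕ → List (List (Fin n))
  tuples d = filter unique? (words d (allFin n))

  ∈-tuples⁺ : ∀ {d a} → IsTuple n d a → a ∈ tuples d
  ∈-tuples⁺ {d} (len , ua) = ∈-filter⁺ unique? (∈-words⁺ d len (All.tabulate (λ {z} _ → ∈-allFin z))) ua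

  length-tuples : ∀ d → length (tuples d) ≤ n ^ d
  length-tuples d = ≤-trans (length-filter unique? (words d (allFin n)))
    (≤-reflexive (trans (length-words (allFin n) d) (cong (_^ d) (length-tabulate (λ i → i)))))

  tuples-hit-often : ∀ {d a} → a ∈ tuples d → length schedules ≤ suc (pred (d !)) * #hitting a
  tuples-hit-often {d} {a} a∈ with a∈words , ua ← ∈-filter⁻ unique? {xs = words d (allFin n)} a∈ =
    subst (λ D → length schedules ≤ D * #hitting a) (sym (suc-pred (d !) {{d !≢0}}))
      (subst (λ l → length schedules ≤ l ! * #hitting a) (proj₁ (∈-words⁻ d a∈words)) (schedules≤d!*#hitting a ua))

  hitting-family-of-length : ∀ d k → pred (d !) ^ k * n ^ d < suc (pred (d !)) ^ k →
    Σ (List (List (Fin n))) λ F → IsHittingFamily n d F × length F ≡ k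
  hitting-family-of-length d k few-left
    with F , lenF , F⊆schedules , hits-all ←
         greedy-hits-all Hits? (pred (d !)) schedules allFin∈schedules (tuples d) (tuples-hit-often {d}) k
           (≤-<-trans (*-monoʳ-≤ (pred (d !) ^ k) (length-tuples d)) few-left) =
    F , (All.map (λ σ∈ → let _ , uσ , cov = ∈-schedules⁻ σ∈ in Unique∧Covering⇒IsSchedule uσ cov) F⊆schedules ,
         λ a tuple → hits-all (∈-tuples⁺ tuple)) , lenF

16≤n^d : ∀ {d n} → 3 ≤ d → d ≤ n → 16 ≤ n ^ d
16≤n^d {d} 3≤d d≤n =
  ≤-trans (≤ᵇ⇒≤ 16 27 _) (≤-trans (^-monoʳ-≤ 3 3≤d) (^-monoˡ-≤ d (≤-trans 3≤d d≤n)))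

small-hitting-family : ∀ d n → 3 ≤ d → d ≤ n →
  Σ (List (List (Fin n))) λ F → IsHittingFamily n d F × 2 ^ length F ≤ n ^ (d ! * d)
small-hitting-family d n 3≤d d≤n
  with j , 2^j≤n^d , n^d<2^[1+j] ← power-of-two-bracket (n ^ d) (≤-trans (s≤s z≤n) (16≤n^d 3≤d d≤n))
  with F , hitting , lenF ← Schedules.hitting-family-of-length n d (suc (pred (d !)) * j)
         (few-rounds-suffice (pred (d !)) j (n ^ d) (16≤n^d 3≤d d≤n) n^d<2^[1+j]) =
  F , hitting , (begin
    2 ^ length F          ≡⟨ cong (2 ^_) (trans lenF (*-comm D j)) ⟩
    2 ^ (j * D)           ≡⟨ ^-*-assoc 2 j D ⟨
    (2 ^ j) ^ D           ≤⟨ ^-monoˡ-≤ D 2^j≤n^d ⟩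
    (n ^ d) ^ D           ≡⟨ ^-*-assoc n d D ⟩
    n ^ (d * D)           ≡⟨ cong (n ^_) (trans (*-comm d D) (cong (_* d) (suc-pred (d !) {{d !≢0}}))) ⟩
    n ^ (d ! * d)         ∎)
  where
  open ≤-Reasoning
  D : ℕ
  D = suc (pred (d !))

++-∷-cancel : ∀ {z : A} u {v} u′ {v′} → z ∉ u′ → z ∉ v′ →
  u ++ z ∷ v ≡ u′ ++ z ∷ v′ → u ≡ u′ × v ≡ v′
++-∷-cancel [] [] _ _ refl = refl , refl
++-∷-cancel [] (x ∷ u′) z∉u′ _ eq = ⊥-elim (z∉u′ (here (∷-injectiveˡ eq)))
++-∷-cancel (x ∷ u) [] _ z∉v′ refl = ⊥-elim (z∉v′ (∈-++⁺ʳ u (here refl)))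
++-∷-cancel (x ∷ u) (x′ ∷ u′) z∉u′ z∉v′ eq with refl , eq′ ← ∷-injective eq
  with refl , refl ← ++-∷-cancel u u′ (z∉u′ ∘ there) z∉v′ eq′ = refl , refl

module _ (_≟_ : DecidableEquality A) where

  prefixBefore : A → List A → List A
  prefixBefore z [] = []
  prefixBefore z (s ∷ σ) with s ≟ z
  ... | yes _ = []
  ... | no _ = s ∷ prefixBefore z σ

  prefixBefore-++-∷ : ∀ {z} p {s} → z ∉ p → prefixBefore z (p ++ z ∷ s) ≡ p
  prefixBefore-++-∷ {z} [] _ with z ≟ z
  ... | yes _ = refl
  ... | no z≢z = ⊥-elim (z≢z refl)
  prefixBefore-++-∷ {z} (x ∷ p) z∉ with x ≟ z
  ... | yes refl = ⊥-elim (z∉ (here refl))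
  ... | no _ = cong (x ∷_) (prefixBefore-++-∷ p (z∉ ∘ there))

  split-at-pivot : ∀ {P : A → Set} (P? : Decidable P) {z σ u v} → Unique σ → P z →
    filter P? σ ≡ u ++ z ∷ v → u ⊆ prefixBefore z σ × (∀ {x} → x ∈ v → x ∉ prefixBefore z σ)
  split-at-pivot P? {z} {σ} {u} {v} uσ Pz hit
    with p , s , refl ← ∈-∃++ (proj₁ (∈-filter⁻ P? {xs = σ} (subst (z ∈_) (sym hit) (∈-++⁺ʳ u (here refl)))))
    =
    (λ x∈u → subst (_ ∈_) (sym prefix≡p) (proj₁ (∈-filter⁻ P? (subst (_ ∈_) (proj₁ cancelled) x∈u)))) ,
    (λ x∈v x∈prefix → Unique-++⁻-disjoint p uσ (subst (_ ∈_) prefix≡p x∈prefix)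
                        (there (proj₁ (∈-filter⁻ P? {xs = s} (subst (_ ∈_) (proj₂ cancelled) x∈v)))) refl)
    where
    z∉p : z ∉ p
    z∉p z∈p = Unique-++⁻-disjoint p uσ z∈p (here refl) refl
    z∉s : z ∉ s
    z∉s z∈s with z≢s ∷ _ ← Unique-++⁻ʳ p uσ = All.lookup z≢s z∈s refl
    prefix≡p : prefixBefore z (p ++ z ∷ s) ≡ p
    prefix≡p = prefixBefore-++-∷ p z∉p
    split : filter P? (p ++ z ∷ s) ≡ filter P? p ++ z ∷ filter P? s
    split = trans (filter-++ P? p (z ∷ s)) (cong (filter P? p ++_) (filter-accept P? Pz))
    cancelled : u ≡ filter P? p × v ≡ filter P? s
    cancelled = ++-∷-cancel u (filter P? p) (z∉p ∘ proj₁ ∘ ∈-filter⁻ P?) (z∉s ∘ proj₁ ∘ ∈-filter⁻ P?)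
      (trans (sym hit) split)

-- Blocks of elements and the lower bound

module Blocks (d q : ℕ) where

  element : ℕ → ℕ → ℕ
  element i r = d + i * q + r

  picked : ℕ → List ℕ → List ℕ
  picked i [] = []
  picked i (r ∷ X) = element i r ∷ picked (suc i) X

  differences : ℕ → List ℕ → List ℕ → List (ℕ × ℕ)
  differences i (r ∷ X) (r′ ∷ X′) with r ℕ.≟ r′
  ... | yes _ = differences (suc i) X X′
  ... | no _ = (element i r , element i r′) ∷ differences (suc i) X X′
  differences i _ _ = []

  blockStart : ℕ → ℕ
  blockStart i = d + i * q

  blockStart-mono : ∀ {i j} → i ≤ j → blockStart i ≤ blockStart j
  blockStart-mono i≤j = +-monoʳ-≤ d (*-monoˡ-≤ q i≤j)

  element-lower : ∀ i r → blockStart i ≤ element i r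
  element-lower i r = m≤m+n (blockStart i) r

  element-upper : ∀ i {r} → r < q → element i r < blockStart (suc i)
  element-upper i {r} r<q = subst (element i r <_) (trans (+-assoc d (i * q) q) (cong (d +_) (+-comm (i * q) q)))
    (+-monoʳ-< (blockStart i) r<q)

  BothFrom : ℕ → ℕ × ℕ → Set
  BothFrom b (k , k′) = b ≤ k × b ≤ k′

  BothBelow : ℕ → ℕ × ℕ → Set
  BothBelow b (k , k′) = k < b × k′ < b

  BothFrom-weaken : ∀ {b b′} → b ≤ b′ → ∀ {pr} → BothFrom b′ pr → BothFrom b pr
  BothFrom-weaken b≤b′ (p , p′) = ≤-trans b≤b′ p , ≤-trans b≤b′ p′

  differences-lower : ∀ i X X′ → All (BothFrom (blockStart i)) (differences i X X′)
  differences-lower i (r ∷ X) (r′ ∷ X′) with r ℕ.≟ r′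
  ... | yes _ = All.map (BothFrom-weaken (blockStart-mono (n≤1+n i))) (differences-lower (suc i) X X′)
  ... | no _ = (element-lower i r , element-lower i r′)
               ∷ All.map (BothFrom-weaken (blockStart-mono (n≤1+n i))) (differences-lower (suc i) X X′)
  differences-lower i [] _ = []
  differences-lower i (_ ∷ _) [] = []

  differences-upper : ∀ i X X′ → All (_< q) X → All (_< q) X′ →
    All (BothBelow (blockStart (i + length X))) (differences i X X′)
  differences-upper i (r ∷ X) (r′ ∷ X′) (r<q ∷ X<q) (r′<q ∷ X′<q) with r ℕ.≟ r′
  ... | yes _ = subst (λ b → All (BothBelow b) (differences (suc i) X X′))
                  (cong blockStart (sym (+-suc i (length X)))) (differences-upper (suc i) X X′ X<q X′<q)
  ... | no _ = (<-≤-trans (element-upper i r<q) next≤ , <-≤-trans (element-upper i r′<q) next≤)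
               ∷ subst (λ b → All (BothBelow b) (differences (suc i) X X′))
                   (cong blockStart (sym (+-suc i (length X)))) (differences-upper (suc i) X X′ X<q X′<q)
    where
    next≤ : blockStart (suc i) ≤ blockStart (i + length (r ∷ X))
    next≤ = blockStart-mono (subst (suc i ≤_) (sym (+-suc i (length X))) (s≤s (m≤m+n i (length X))))
  differences-upper i [] _ _ _ = []
  differences-upper i (_ ∷ _) [] _ _ = []

  length-differences : ∀ i X X′ → length (differences i X X′) ≤ length X
  length-differences i (r ∷ X) (r′ ∷ X′) with r ℕ.≟ r′
  ... | yes _ = m≤n⇒m≤1+n (length-differences (suc i) X X′)
  ... | no _ = s≤s (length-differences (suc i) X X′)
  length-differences i [] _ = z≤n
  length-differences i (_ ∷ _) [] = z≤n

  private
    firsts-lower : ∀ i X X′ {k} → k ∈ map proj₁ (differences i X X′) → blockStart i ≤ k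
    firsts-lower i X X′ k∈ with pr , pr∈ , refl ← ∈-map⁻ proj₁ k∈ =
      proj₁ (All.lookup (differences-lower i X X′) pr∈)

    seconds-lower : ∀ i X X′ {k} → k ∈ map proj₂ (differences i X X′) → blockStart i ≤ k
    seconds-lower i X X′ k∈ with pr , pr∈ , refl ← ∈-map⁻ proj₂ k∈ =
      proj₂ (All.lookup (differences-lower i X X′) pr∈)

  Unique-firsts : ∀ i X X′ → All (_< q) X → Unique (map proj₁ (differences i X X′))
  Unique-firsts i (r ∷ X) (r′ ∷ X′) (r<q ∷ X<q) with r ℕ.≟ r′
  ... | yes _ = Unique-firsts (suc i) X X′ X<q
  ... | no _ =
    All.tabulate (λ k∈ r≡k → <⇒≢ (<-≤-trans (element-upper i r<q) (firsts-lower (suc i) X X′ k∈)) r≡k)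
               ∷ Unique-firsts (suc i) X X′ X<q
  Unique-firsts i [] _ _ = []
  Unique-firsts i (_ ∷ _) [] _ = []

  Unique-seconds : ∀ i X X′ → All (_< q) X′ → Unique (map proj₂ (differences i X X′))
  Unique-seconds i (r ∷ X) (r′ ∷ X′) (r′<q ∷ X′<q) with r ℕ.≟ r′
  ... | yes _ = Unique-seconds (suc i) X X′ X′<q
  ... | no _ =
    All.tabulate (λ k∈ r′≡k → <⇒≢ (<-≤-trans (element-upper i r′<q) (seconds-lower (suc i) X X′ k∈)) r′≡k)
               ∷ Unique-seconds (suc i) X X′ X′<q
  Unique-seconds i [] _ _ = []
  Unique-seconds i (_ ∷ _) [] _ = []

  firsts-seconds-disjoint : ∀ i X X′ → All (_< q) X → All (_< q) X′ →
    ∀ {k} → k ∈ map proj₁ (differences i X X′) → k ∉ map proj₂ (differences i X X′)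
  firsts-seconds-disjoint i (r ∷ X) (r′ ∷ X′) (r<q ∷ X<q) (r′<q ∷ X′<q) with r ℕ.≟ r′
  ... | yes _ = firsts-seconds-disjoint (suc i) X X′ X<q X′<q
  ... | no r≢r′ = λ
    { (here refl) (here eq) → r≢r′ (+-cancelˡ-≡ (blockStart i) r r′ eq)
    ; (here refl) (there k∈) → <-irrefl refl (<-≤-trans (element-upper i r<q) (seconds-lower (suc i) X X′ k∈))
    ; (there k∈) (here refl) → <-irrefl refl (<-≤-trans (element-upper i r′<q) (firsts-lower (suc i) X X′ k∈))
    ; (there k∈) (there k∈′) → firsts-seconds-disjoint (suc i) X X′ X<q X′<q k∈ k∈′ }
  firsts-seconds-disjoint i [] _ _ _ ()
  firsts-seconds-disjoint i (_ ∷ _) [] _ _ ()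

  length-picked : ∀ i X → length (picked i X) ≡ length X
  length-picked i [] = refl
  length-picked i (r ∷ X) = cong suc (length-picked (suc i) X)

  module _ {Before : ℕ → Set} (before? : Decidable Before) where

    #pickedBefore : ℕ → List ℕ → ℕ
    #pickedBefore i X = length (filter before? (picked i X))

    #pickedBefore≤length : ∀ i X → #pickedBefore i X ≤ length X
    #pickedBefore≤length i X = subst (#pickedBefore i X ≤_) (length-picked i X) (length-filter before? (picked i X))

    -- The non-strict half carries the induction through the blocks where X and X′ agree.
    #pickedBefore-separates : ∀ i X X′ → length X ≡ length X′ →
      (∀ {k} → k ∈ map proj₁ (differences i X X′) → Before k) →
      (∀ {k} → k ∈ map proj₂ (differences i X X′) → ¬ Before k) →
      #pickedBefore i X′ ≤ #pickedBefore i X × (¬ X ≡ X′ → #pickedBefore i X′ < #pickedBefore i X)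
    #pickedBefore-separates i [] [] _ _ _ = ≤-refl , λ []≢[] → ⊥-elim ([]≢[] refl)
    #pickedBefore-separates i (r ∷ X) (r′ ∷ X′) len before not-before with r ℕ.≟ r′
    ... | yes refl with ih≤ , ih< ← #pickedBefore-separates (suc i) X X′ (suc-injective len) before not-before
                   with before? (element i r)
    ...   | yes _ = s≤s ih≤ , λ X≢X′ → s≤s (ih< (X≢X′ ∘ cong (r ∷_)))
    ...   | no _ = ih≤ , λ X≢X′ → ih< (X≢X′ ∘ cong (r ∷_))
    #pickedBefore-separates i (r ∷ X) (r′ ∷ X′) len before not-before | no _
      with ih≤ , _ ← #pickedBefore-separates (suc i) X X′ (suc-injective len) (before ∘ there) (not-before ∘ there)
      with before? (element i r) | before? (element i r′)
    ...   | yes _ | no _ = <⇒≤ (s≤s ih≤) , λ _ → s≤s ih≤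
    ...   | no ¬b | _ = ⊥-elim (¬b (before (here refl)))
    ...   | _ | yes b′ = ⊥-elim (not-before (here refl) b′)

1+n≤2^n : ∀ t → 1 ≤ t → suc t ≤ 2 ^ t
1+n≤2^n (suc zero) _ = ≤-refl
1+n≤2^n (suc (suc t)) _ = +-mono-≤ (m^n>0 2 (suc t))
  (subst (suc (suc t) ≤_) (sym (+-identityʳ (2 ^ suc t))) (1+n≤2^n (suc t) (s≤s z≤n)))

^-cancelʳ-≤ : ∀ t .{{_ : NonZero t}} {a b} → a ^ t ≤ b ^ t → a ≤ b
^-cancelʳ-≤ t {a} {b} a^t≤b^t with a ≤? b
... | yes a≤b = a≤b
... | no a≰b = contradiction a^t≤b^t (<⇒≱ (^-monoˡ-< t (≰⇒> a≰b)))

halving : ∀ d → 3 ≤ d → Σ ℕ λ t → 1 ≤ t × t + t < d × d ≤ suc (suc (t + t))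
halving 1 (s≤s ())
halving 2 (s≤s (s≤s ()))
halving 3 _ = 1 , ≤-refl , ≤-refl , n≤1+n 3
halving 4 _ = 1 , ≤-refl , n≤1+n 3 , ≤-refl
halving (suc (suc d@(suc (suc (suc _))))) _ with t , 1≤t , t+t<d , d≤ ← halving d (s≤s (s≤s (s≤s z≤n))) =
  suc t , s≤s z≤n , subst (_< suc (suc d)) (sym (+-suc (suc t) t)) (s≤s (s≤s t+t<d)) ,
  subst (λ x → suc (suc d) ≤ suc (suc x)) (sym (+-suc (suc t) t)) (s≤s (s≤s d≤))

-- (t+1)^d ≤ (t+1)^(2t) 4^t = (2t+2)^(2t) ≤ (d+1)^(2t)
halving-power : ∀ d t → 1 ≤ t → t + t < d → d ≤ suc (suc (t + t)) → suc t ^ d ≤ suc d ^ (t + t)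
halving-power d t 1≤t t+t<d d≤ = begin
  suc t ^ d                               ≤⟨ ^-monoʳ-≤ (suc t) (subst (d ≤_) (+-comm 2 (t + t)) d≤) ⟩
  suc t ^ (t + t + 2)                     ≡⟨ ^-distribˡ-+-* (suc t) (t + t) 2 ⟩
  suc t ^ (t + t) * suc t ^ 2             ≤⟨ *-monoʳ-≤ (suc t ^ (t + t)) (^-monoˡ-≤ 2 (1+n≤2^n t 1≤t)) ⟩
  suc t ^ (t + t) * (2 ^ t) ^ 2           ≡⟨ cong (suc t ^ (t + t) *_) (^-*-assoc 2 t 2) ⟩
  suc t ^ (t + t) * 2 ^ (t * 2)           ≡⟨ cong (λ e → suc t ^ (t + t) * 2 ^ e) (t*2≡t+t t) ⟩
  suc t ^ (t + t) * 2 ^ (t + t)           ≡⟨ ^-distribʳ-* (suc t) 2 (t + t) ⟨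
  (suc t * 2) ^ (t + t)                   ≤⟨ ^-monoˡ-≤ (t + t) (subst (_≤ suc d) (t+t+2≡[1+t]*2 t) (s≤s t+t<d)) ⟩
  suc d ^ (t + t)                         ∎
  where
  open ≤-Reasoning
  t+t+2≡[1+t]*2 : ∀ t → suc (suc (t + t)) ≡ suc t * 2
  t+t+2≡[1+t]*2 = solve-∀
  t*2≡t+t : ∀ t → t * 2 ≡ t + t
  t*2≡t+t = solve-∀

power-transfer : ∀ {q t m d} → 1 ≤ t → q ^ t ≤ suc t ^ m → suc t ^ d ≤ suc d ^ (t + t) →
  q ^ d ≤ suc d ^ (2 * m)
power-transfer {q} {t} {m} {d} 1≤t q^t≤ [1+t]^d≤ = ^-cancelʳ-≤ t {{>-nonZero 1≤t}} (begin
  (q ^ d) ^ t              ≡⟨ ^-*-assoc q d t ⟩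
  q ^ (d * t)              ≡⟨ cong (q ^_) (*-comm d t) ⟩
  q ^ (t * d)              ≡⟨ ^-*-assoc q t d ⟨
  (q ^ t) ^ d              ≤⟨ ^-monoˡ-≤ d q^t≤ ⟩
  (suc t ^ m) ^ d          ≡⟨ ^-*-assoc (suc t) m d ⟩
  suc t ^ (m * d)          ≡⟨ cong (suc t ^_) (*-comm m d) ⟩
  suc t ^ (d * m)          ≡⟨ ^-*-assoc (suc t) d m ⟨
  (suc t ^ d) ^ m          ≤⟨ ^-monoˡ-≤ m [1+t]^d≤ ⟩
  (suc d ^ (t + t)) ^ m    ≡⟨ trans (^-*-assoc (suc d) (t + t) m) (cong (suc d ^_) ([t+t]*m≡2*m*t t m)) ⟩
  suc d ^ (2 * m * t)      ≡⟨ ^-*-assoc (suc d) (2 * m) t ⟨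
  (suc d ^ (2 * m)) ^ t    ∎)
  where
  open ≤-Reasoning
  [t+t]*m≡2*m*t : ∀ t m → (t + t) * m ≡ 2 * m * t
  [t+t]*m≡2*m*t = solve-∀

private
  d+d≤[1+d]² : ∀ d → d + d ≤ suc d * suc d
  d+d≤[1+d]² d = subst (d + d ≤_) (expand d) (≤-trans (m≤m+n (d + d) (d * d)) (n≤1+n _))
    where
    expand : ∀ d → suc (d + d + d * d) ≡ suc d * suc d
    expand = solve-∀

  n≤[1+d]²*q : ∀ {d n t q} → t + t ≤ d → 1 ≤ q → n < d + t * suc q → n ≤ suc d * suc d * q
  n≤[1+d]²*q {d} {n} {t} {q} t+t≤d 1≤q n< = begin
    n                       ≤⟨ <⇒≤ n< ⟩
    d + t * suc q           ≡⟨ expand d t q ⟩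
    d + t * q + t           ≤⟨ +-mono-≤ (+-monoˡ-≤ (t * q) (m≤m*n d q)) (m≤m*n t q) ⟩
    d * q + t * q + t * q   ≡⟨ regroup d t q ⟩
    d * q + (t + t) * q     ≤⟨ +-monoʳ-≤ (d * q) (*-monoˡ-≤ q t+t≤d) ⟩
    d * q + d * q           ≡⟨ *-distribʳ-+ q d d ⟨
    (d + d) * q             ≤⟨ *-monoˡ-≤ q (d+d≤[1+d]² d) ⟩
    suc d * suc d * q       ∎
    where
    open ≤-Reasoning
    instance
      q≢0 : NonZero q
      q≢0 = >-nonZero 1≤q
    expand : ∀ d t q → d + t * suc q ≡ d + t * q + t
    expand = solve-∀
    regroup : ∀ d t q → d * q + t * q + t * q ≡ d * q + (t + t) * q
    regroup = solve-∀

  square-power : ∀ a d → (a * a) ^ d ≡ a ^ (2 * d)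
  square-power a d = trans (^-distribʳ-* a a d)
    (trans (sym (^-distribˡ-+-* a d d)) (cong (λ e → a ^ (d + e)) (sym (+-identityʳ d))))

lower-bound-arithmetic : ∀ {d n t q m} → 1 ≤ t → t + t < d → d ≤ suc (suc (t + t)) →
  n < d + t * suc q → q ^ t ≤ suc t ^ m → n ^ d ≤ suc d ^ (2 * m + 2 * d)
lower-bound-arithmetic {d} {n} {t} {zero} {m} 1≤t t+t<d _ n< _ = begin
  n ^ d                    ≤⟨ ^-monoˡ-≤ d (≤-trans n≤d+d (d+d≤[1+d]² d)) ⟩
  (suc d * suc d) ^ d      ≡⟨ square-power (suc d) d ⟩
  suc d ^ (2 * d)          ≤⟨ ^-monoʳ-≤ (suc d) (m≤n+m (2 * d) (2 * m)) ⟩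
  suc d ^ (2 * m + 2 * d)  ∎
  where
  open ≤-Reasoning
  n≤d+d : n ≤ d + d
  n≤d+d = ≤-trans (<⇒≤ n<)
    (+-monoʳ-≤ d (≤-trans (≤-reflexive (*-identityʳ t)) (≤-trans (m≤m+n t t) (<⇒≤ t+t<d))))
lower-bound-arithmetic {d} {n} {t} {q@(suc _)} {m} 1≤t t+t<d d≤ n< q^t≤ = begin
  n ^ d                                  ≤⟨ ^-monoˡ-≤ d (n≤[1+d]²*q {d} {n} {t} {q} (<⇒≤ t+t<d) (s≤s z≤n) n<) ⟩
  (suc d * suc d * q) ^ d                ≡⟨ ^-distribʳ-* (suc d * suc d) q d ⟩
  (suc d * suc d) ^ d * q ^ d
    ≤⟨ *-monoʳ-≤ ((suc d * suc d) ^ d)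
         (power-transfer {q} {t} {m} {d} 1≤t q^t≤ (halving-power d t 1≤t t+t<d d≤)) ⟩
  (suc d * suc d) ^ d * suc d ^ (2 * m)  ≡⟨ cong (_* suc d ^ (2 * m)) (square-power (suc d) d) ⟩
  suc d ^ (2 * d) * suc d ^ (2 * m)      ≡⟨ ^-distribˡ-+-* (suc d) (2 * d) (2 * m) ⟨
  suc d ^ (2 * d + 2 * m)                ≡⟨ cong (suc d ^_) (+-comm (2 * d) (2 * m)) ⟩
  suc d ^ (2 * m + 2 * d)                ∎
  where open ≤-Reasoning

module Separation (d n t q : ℕ) (t+t<d : t + t < d) (blocks-fit : d + t * q ≤ n) where

  open Blocks d q
  open import Data.List.Membership.DecPropositional (_≟_ {n}) using (_∈?_)

  private instance
    n≢0 : NonZero n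
    n≢0 = >-nonZero (≤-trans (<-≤-trans (s≤s z≤n) t+t<d) (≤-trans (m≤m+n d (t * q)) blocks-fit))

  -- Only ever applied to numbers below n, where it is the canonical embedding.
  toFin : ℕ → Fin n
  toFin k = k mod n

  toℕ-toFin : ∀ {k} → k < n → toℕ (toFin k) ≡ k
  toℕ-toFin {k} k<n = trans (toℕ-fromℕ< _) (m<n⇒m%n≡m k<n)

  pivot : Fin n
  pivot = toFin 0

  #before : List (Fin n) → List ℕ → ℕ
  #before σ = #pickedBefore (λ k → toFin k ∈? prefixBefore _≟_ pivot σ) 0

  choices : List (List ℕ)
  choices = words t (upTo q)

  ∈-choices⁻ : ∀ {X} → X ∈ choices → length X ≡ t × All (_< q) X
  ∈-choices⁻ X∈ with len , X⊆ ← ∈-words⁻ t X∈ = len , All.map ∈-upTo⁻ X⊆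

  -- A tuple that is hit only by schedules putting X before the pivot and X′ after it, where they differ.
  module _ (X X′ : List ℕ) where

    firsts seconds padding : List ℕ
    firsts = map proj₁ (differences 0 X X′)
    seconds = map proj₂ (differences 0 X X′)
    padding = map suc (upTo (d ∸ suc (length firsts + length seconds)))

    separatingTuple : List ℕ
    separatingTuple = firsts ++ 0 ∷ seconds ++ padding

    module _ (X∈ : X ∈ choices) (X′∈ : X′ ∈ choices) where

      private
        X<q : All (_< q) X
        X<q = proj₂ (∈-choices⁻ X∈)
        X′<q : All (_< q) X′
        X′<q = proj₂ (∈-choices⁻ X′∈)
        top : blockStart (0 + length X) ≤ n
        top = subst (λ l → d + l * q ≤ n) (sym (proj₁ (∈-choices⁻ X∈))) blocks-fit
        bottom : d ≡ blockStart 0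
        bottom = sym (+-identityʳ d)

      firsts-range : ∀ {k} → k ∈ firsts → d ≤ k × k < n
      firsts-range k∈ with pr , pr∈ , refl ← ∈-map⁻ proj₁ k∈ =
        subst (_≤ _) (sym bottom) (proj₁ (All.lookup (differences-lower 0 X X′) pr∈)) ,
        <-≤-trans (proj₁ (All.lookup (differences-upper 0 X X′ X<q X′<q) pr∈)) top

      seconds-range : ∀ {k} → k ∈ seconds → d ≤ k × k < n
      seconds-range k∈ with pr , pr∈ , refl ← ∈-map⁻ proj₂ k∈ =
        subst (_≤ _) (sym bottom) (proj₂ (All.lookup (differences-lower 0 X X′) pr∈)) ,
        <-≤-trans (proj₂ (All.lookup (differences-upper 0 X X′ X<q X′<q) pr∈)) top

      padding-range : ∀ {k} → k ∈ padding → 1 ≤ k × k < d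
      padding-range k∈ with j , j∈ , refl ← ∈-map⁻ suc k∈ = s≤s z≤n , below d (∈-upTo⁻ j∈)
        where
        below : ∀ d {x j} → j < d ∸ suc x → suc j < d
        below (suc d) {x} j< = s≤s (≤-trans j< (m∸n≤m d x))

      Unique-separatingTuple : Unique separatingTuple
      Unique-separatingTuple =
        Unique.++⁺ (Unique-firsts 0 X X′ X<q) (All.tabulate 0∉ ∷ Unique-seconds++padding) firsts-disjoint
        where
        0∉ : ∀ {k} → k ∈ seconds ++ padding → ¬ 0 ≡ k
        0∉ k∈ refl with ∈-++⁻ seconds k∈
        ... | inj₁ k∈s = <⇒≱ (<-≤-trans (<-≤-trans (s≤s z≤n) t+t<d) (proj₁ (seconds-range k∈s))) z≤n
        ... | inj₂ k∈p = <⇒≱ (proj₁ (padding-range k∈p)) z≤n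
        Unique-seconds++padding : Unique (seconds ++ padding)
        Unique-seconds++padding = Unique.++⁺ (Unique-seconds 0 X X′ X′<q)
          (Unique.map⁺ suc-injective (Unique.upTo⁺ (d ∸ suc (length firsts + length seconds))))
          (λ (k∈s , k∈p) → <⇒≱ (proj₂ (padding-range k∈p)) (proj₁ (seconds-range k∈s)))
        firsts-disjoint : ∀ {k} → ¬ (k ∈ firsts × k ∈ 0 ∷ seconds ++ padding)
        firsts-disjoint (k∈f , here refl) =
          <⇒≱ (<-≤-trans (<-≤-trans (s≤s z≤n) t+t<d) (proj₁ (firsts-range k∈f))) z≤n
        firsts-disjoint (k∈f , there k∈) with ∈-++⁻ seconds k∈
        ... | inj₁ k∈s = firsts-seconds-disjoint 0 X X′ X<q X′<q k∈f k∈s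
        ... | inj₂ k∈p = <⇒≱ (proj₂ (padding-range k∈p)) (proj₁ (firsts-range k∈f))

      length-separatingTuple : length separatingTuple ≡ d
      length-separatingTuple = begin
        length separatingTuple                ≡⟨ length-++ firsts ⟩
        b + suc (length (seconds ++ padding))  ≡⟨ cong (λ l → b + suc l) (length-++ seconds) ⟩
        b + suc (b′ + length padding)
          ≡⟨ cong (λ l → b + suc (b′ + l)) (trans (length-map suc (upTo p)) (length-upTo p)) ⟩
        b + suc (b′ + (d ∸ suc (b + b′)))      ≡⟨ rearrange b b′ (d ∸ suc (b + b′)) ⟩
        d ∸ suc (b + b′) + suc (b + b′)        ≡⟨ m∸n+n≡m fits ⟩
        d                                      ∎
        where
        open ≡-Reasoning
        b b′ : ℕ
        b = length firsts
        b′ = length seconds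
        p : ℕ
        p = d ∸ suc (b + b′)
        rearrange : ∀ b b′ p → b + suc (b′ + p) ≡ p + suc (b + b′)
        rearrange = solve-∀
        b≤t : ∀ {A : Set} (f : ℕ × ℕ → A) → length (map f (differences 0 X X′)) ≤ t
        b≤t f = subst₂ _≤_ (sym (length-map f (differences 0 X X′))) (proj₁ (∈-choices⁻ X∈))
          (length-differences 0 X X′)
        fits : suc (b + b′) ≤ d
        fits = ≤-trans (s≤s (+-mono-≤ (b≤t proj₁) (b≤t proj₂))) t+t<d

      separatingTuple<n : ∀ {k} → k ∈ separatingTuple → k < n
      separatingTuple<n k∈ with ∈-++⁻ firsts k∈
      ... | inj₁ k∈f = proj₂ (firsts-range k∈f)
      ... | inj₂ (here refl) = <-≤-trans (<-≤-trans (s≤s z≤n) t+t<d) (≤-trans (m≤m+n d (t * q)) blocks-fit)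
      ... | inj₂ (there k∈) with ∈-++⁻ seconds k∈
      ...   | inj₁ k∈s = proj₂ (seconds-range k∈s)
      ...   | inj₂ k∈p = <-≤-trans (proj₂ (padding-range k∈p)) (≤-trans (m≤m+n d (t * q)) blocks-fit)

      separatingTuple-IsTuple : IsTuple n d (map toFin separatingTuple)
      separatingTuple-IsTuple = trans (length-map toFin separatingTuple) length-separatingTuple ,
        Unique-map toFin toFin-injective Unique-separatingTuple
        where
        toFin-injective : InjectiveOn toFin separatingTuple
        toFin-injective k∈ k′∈ eq = trans (sym (toℕ-toFin (separatingTuple<n k∈)))
          (trans (cong toℕ eq) (toℕ-toFin (separatingTuple<n k′∈)))

    Hits⇒#before-< : ∀ {σ} → Unique σ → Hits σ (map toFin separatingTuple) → ¬ X ≡ X′ →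
      length X ≡ length X′ → #before σ X′ < #before σ X
    Hits⇒#before-< {σ} uσ hit X≢X′ len =
      proj₂ (#pickedBefore-separates _ 0 X X′ len
              (λ k∈ → proj₁ split (∈-map⁺ toFin k∈))
              (λ k∈ → proj₂ split (∈-++⁺ˡ (∈-map⁺ toFin k∈))))
            X≢X′
      where
      a : List (Fin n)
      a = map toFin separatingTuple
      a≡ : a ≡ map toFin firsts ++ pivot ∷ (map toFin seconds ++ map toFin padding)
      a≡ = trans (map-++ toFin firsts (0 ∷ seconds ++ padding))
        (cong (λ w → map toFin firsts ++ pivot ∷ w) (map-++ toFin seconds padding))
      split : map toFin firsts ⊆ prefixBefore _≟_ pivot σ ×
              (∀ {x} → x ∈ map toFin seconds ++ map toFin padding → x ∉ prefixBefore _≟_ pivot σ)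
      split = split-at-pivot _≟_ (_∈? a) uσ (subst (pivot ∈_) (sym a≡) (∈-++⁺ʳ (map toFin firsts) (here refl)))
        (trans hit a≡)

  signature : List (List (Fin n)) → List ℕ → List ℕ
  signature F X = map (λ σ → #before σ X) F

  -- A hitting family distinguishes all choices, and each signature entry lies in 0..t.
  choices≤signatures : ∀ F → IsHittingFamily n d F → q ^ t ≤ suc t ^ length F
  choices≤signatures F (F-schedules , F-hits) = subst₂ _≤_
    (trans (length-words (upTo q) t) (cong (_^ t) (length-upTo q)))
    (trans (length-words (upTo (suc t)) (length F)) (cong (_^ length F) (length-upTo (suc t))))
    (injection⇒length-≤ (signature F) (Unique-words t (Unique.upTo⁺ q)) signature-injective signature∈)
    where
    signature∈ : ∀ {X} → X ∈ choices → signature F X ∈ words (length F) (upTo (suc t))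
    signature∈ {X} X∈ = ∈-words⁺ (length F) (length-map _ F) (All.tabulate entry∈)
      where
      entry∈ : ∀ {v} → v ∈ signature F X → v ∈ upTo (suc t)
      entry∈ v∈ with σ , _ , refl ← ∈-map⁻ (λ σ → #before σ X) v∈ =
        ∈-upTo⁺ (s≤s (subst (#before σ X ≤_) (proj₁ (∈-choices⁻ X∈)) (#pickedBefore≤length _ 0 X)))
    signature-injective : InjectiveOn (signature F) choices
    signature-injective {X} {X′} X∈ X′∈ same with ≡-dec ℕ._≟_ X X′
    ... | yes X≡X′ = X≡X′
    ... | no X≢X′ with σ , σ∈F , hit ← find (F-hits _ (separatingTuple-IsTuple X X′ X∈ X′∈)) =
      ⊥-elim (<-irrefl (sym (map-≡⇒≡ same σ∈F))
        (Hits⇒#before-< X X′ (Unique-resp-↭ (↭-sym (All.lookup F-schedules σ∈F)) (Unique.allFin⁺ n)) hit X≢X′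
          (trans (proj₁ (∈-choices⁻ X∈)) (sym (proj₁ (∈-choices⁻ X′∈))))))

large-hitting-family : ∀ d n → 3 ≤ d → d ≤ n → ∀ F → IsHittingFamily n d F →
  n ^ d ≤ suc d ^ (2 * length F + 2 * d)
large-hitting-family d n 3≤d d≤n F hitting with t , 1≤t , t+t<d , d≤2t+2 ← halving d 3≤d =
  lower-bound-arithmetic {m = length F} 1≤t t+t<d d≤2t+2 n<d+t[1+q]
    (Separation.choices≤signatures d n t q t+t<d blocks-fit F hitting)
  where
  instance
    t≢0 : NonZero t
    t≢0 = >-nonZero 1≤t
  q : ℕ
  q = (n ∸ d) / t
  n≡d+[n∸d] : n ≡ d + (n ∸ d)
  n≡d+[n∸d] = sym (m+[n∸m]≡n d≤n)
  blocks-fit : d + t * q ≤ n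
  blocks-fit = subst (d + t * q ≤_) (sym n≡d+[n∸d])
    (+-monoʳ-≤ d (subst (_≤ n ∸ d) (*-comm q t) (m/n*n≤m (n ∸ d) t)))
  n<d+t[1+q] : n < d + t * suc q
  n<d+t[1+q] = subst (_< d + t * suc q) (sym n≡d+[n∸d]) (+-monoʳ-< d (begin-strict
    n ∸ d                    ≡⟨ m≡m%n+[m/n]*n (n ∸ d) t ⟩
    (n ∸ d) % t + q * t      <⟨ +-monoˡ-< (q * t) (m%n<n (n ∸ d) t) ⟩
    t + q * t                ≡⟨ cong (t +_) (*-comm q t) ⟩
    t + t * q                ≡⟨ *-suc t q ⟨
    t * suc q                ∎))
    where open ≤-Reasoning

theorem1 : (d : ℕ) → d ≥ 3 →
    Σ ℕ λ K → (n : ℕ) → n ≥ d → (m : ℕ) → IsMinHittingSize n d m →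
    (n ^ d ≤ (d + 1) ^ (2 * m + K)) × (2 ^ m ≤ n ^ ((d !) * d))
theorem1 d 3≤d = 2 * d , λ where
  n d≤n .(length F) ((F , F-hitting , refl) , minimal) →
    subst (λ b → n ^ d ≤ b ^ (2 * length F + 2 * d)) (+-comm 1 d) (large-hitting-family d n 3≤d d≤n F F-hitting) ,
    (let G , G-hitting , 2^|G|≤ = small-hitting-family d n 3≤d d≤n
     in ≤-trans (^-monoʳ-≤ 2 (minimal G G-hitting)) 2^|G|≤)
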